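{- Let $m\ge 3$ be an integer and let $\mathscr{C}_m=\{\emptyset,\{1\},\{1,2\},\dots,\{1,2,\dots,m-1\}\}$, a code on $m-1$ neurons. Then the general relationship graph $G(\mathscr{C}_m)$ is a graph on $m-1$ vertices with no edges.
   Context: A neural code on $n$ neurons is a collection of subsets of $[n]$. A pseudo-monomial in $\mathbb{F}_2[x_1,\dots,x_n]$ is $\prod_{i\in\sigma}x_i\prod_{j\in\tau}(1-x_j)$ with $\sigma\cap\tau=\emptyset$. For an ideal $J$, a pseudo-monomial $f\in J$ is minimal if there is no pseudo-monomial $g\in J$ with $\deg g<\deg f$ and $g\mid f$; $\mathrm{CF}(J)$ is the set of minimal pseudo-monomials of $J$. With $\rho_v=\prod_{i\in v}x_i\prod_{j\notin v}(1-x_j)$, the neural ideal is $\mathcal{J}_\mathcal{C}=\langle\rho_v\mid v\subseteq[n],v\notin\mathcal{C}\rangle$. For $\sigma\subseteq[n]$ let $E_\sigma=\{x_i,1-x_i\mid i\in\sigma\}$. The general relationship complex is $GR(\mathcal{C})=\{\sigma\subseteq[n]\mid \prod_{\gamma\in\Gamma}\gamma\notin\mathrm{CF}(\mathcal{J}_\mathcal{C})\text{ for every }\Gamma\subseteq E_\sigma\}$, and the general relationship graph $G(\mathcal{C})$ is its $1$-skeleton: vertices are the $i\in[n]$ with $\{i\}\in GR(\mathcal{C})$ and edges are the pairs $\{i,j\}\in GR(\mathcal{C})$. -}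

module Defs where

open import Data.Nat using (ℕ; zero; suc; _+_; _<_; _≤_; _<ᵇ_)
open import Data.Bool using (Bool; true; false; if_then_else_; _xor_)
open import Data.Fin using (Fin; toℕ)
open import Data.Fin.Subset using (Subset; _∈_; _∉_; _⊆_; ∣_∣)
open import Data.Vec using (Vec; []; _∷_; replicate; zipWith; lookup; tabulate)
open import Data.Vec.Properties using (≡-dec)
open import Data.List using (List; []; _∷_; _++_; map; concatMap; foldr)
open import Data.List.Relation.Unary.All using (All)
open import Data.Product using (Σ; _×_; _,_; proj₁; proj₂)
open import Relation.Nullary using (¬_; does)
open import Relation.Binary.PropositionalEquality using (_≡_)
import Data.Nat as ℕ

-- The polynomial ring F₂[x₀,…,x_{n-1}]
-- A monomial is its exponent vector; a polynomial is a finite list of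
-- monomials, whose coefficient (in F₂) at a monomial α is the parity of
-- the number of occurrences of α.

Monomial : ℕ → Set
Monomial n = Vec ℕ n

Poly : ℕ → Set
Poly n = List (Monomial n)

coeff : ∀ {n} → Poly n → Monomial n → Bool
coeff []       α = false
coeff (β ∷ f)  α = does (≡-dec ℕ._≟_ β α) xor coeff f α

_≈_ : ∀ {n} → Poly n → Poly n → Set
f ≈ g = ∀ α → coeff f α ≡ coeff g α

0p : ∀ {n} → Poly n
0p = []

1p : ∀ {n} → Poly n
1p {n} = replicate n 0 ∷ []

_+p_ : ∀ {n} → Poly n → Poly n → Poly n
f +p g = f ++ g

_*p_ : ∀ {n} → Poly n → Poly n → Poly n
f *p g = concatMap (λ a → map (λ b → zipWith _+_ a b) g) f

xv : ∀ {n} → Fin n → Poly n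
xv i = tabulate (λ j → if does (i Data.Fin.≟ j) then 1 else 0) ∷ []

-- 1 - x_i  (= 1 + x_i over F₂)
1-x : ∀ {n} → Fin n → Poly n
1-x i = 1p +p xv i

allFinL : ∀ n → List (Fin n)
allFinL n = Data.List.allFin n

-- ∏_{i∈σ} x_i ∏_{j∈τ} (1 - x_j)   (for arbitrary σ, τ; a pseudo-monomial
-- when σ ∩ τ = ∅)
pm : ∀ {n} → Subset n → Subset n → Poly n
pm {n} σ τ = foldr (λ i acc →
                (if lookup σ i then xv i else 1p) *p
                ((if lookup τ i then 1-x i else 1p) *p acc))
             1p (allFinL n)

Disjoint : ∀ {n} → Subset n → Subset n → Set
Disjoint σ τ = ∀ i → i ∈ σ → i ∉ τ

_∣p_ : ∀ {n} → Poly n → Poly n → Set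
g ∣p f = Σ _ λ h → f ≈ (h *p g)

Code : ℕ → Set₁
Code n = Subset n → Set

ρ : ∀ {n} → Subset n → Poly n
ρ {n} v = pm v (tabulate (λ i → Data.Bool.not (lookup v i)))

sumGen : ∀ {n} → List (Poly n × Subset n) → Poly n
sumGen []            = 0p
sumGen ((g , v) ∷ L) = (g *p ρ v) +p sumGen L

InNeuralIdeal : ∀ {n} → Code n → Poly n → Set
InNeuralIdeal C f =
  Σ (List (_ × _)) λ L → All (λ p → ¬ C (proj₂ p)) L × (f ≈ sumGen L)

InCF : ∀ {n} → Code n → Poly n → Set
InCF C f =
  Σ _ λ σ → Σ _ λ τ →
    Disjoint σ τ × f ≈ pm σ τ × InNeuralIdeal C (pm σ τ) ×
    ¬ (Σ _ λ σ' → Σ _ λ τ' →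
         Disjoint σ' τ' × InNeuralIdeal C (pm σ' τ') ×
         (∣ σ' ∣ + ∣ τ' ∣ < ∣ σ ∣ + ∣ τ ∣) × (pm σ' τ' ∣p pm σ τ))

-- s ∈ GR(C): for every Γ ⊆ E_s, the product of Γ is not in CF(J_C).
-- Γ is given by A = {i | x_i ∈ Γ}, B = {i | 1 - x_i ∈ Γ}, A, B ⊆ s;
-- its product is pm A B.
InGR : ∀ {n} → Code n → Subset n → Set
InGR C s = ∀ A B → A ⊆ s → B ⊆ s → ¬ InCF C (pm A B)

-- The code 𝒞_m on n = m - 1 neurons (neurons 1..n are Fin indices 0..n-1)

prefix : ∀ {n} → ℕ → Subset n
prefix k = tabulate (λ i → toℕ i <ᵇ k)

prefixCode : ∀ n → Code n
prefixCode n v = Σ ℕ λ k → k ≤ n × v ≡ prefix k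

-- Evaluation at a point c ∈ {0,1}ⁿ is well defined on F₂[x] and kills the neural ideal at every
-- codeword.  The code contains ∅ and [n], and a pseudo-monomial x_σ (1 - x)_τ with σ = ∅ (resp.
-- τ = ∅) equals 1 at ∅ (resp. [n]), so every pseudo-monomial of J_𝒞 has σ ≠ ∅ and τ ≠ ∅.  For a
-- singleton {i} this leaves only x_i (1 - x_i) = 0, which is not a genuine pseudo-monomial, so no
-- element of CF(J_𝒞) is built from E_{i}.  For i < j, x_j (1 - x_i) vanishes on every prefix, hence
-- is the sum of the ρ_v it covers, none of which is a codeword; having degree 2 it is minimal.

module Submission where

open import Defs
open import Algebra.Bundles using (CommutativeMonoid; CommutativeRing)
import Algebra.Properties.CommutativeSemigroup as CommutativeSemigroupProperties
open import Data.Bool using (Bool; true; false; not; _∧_; _∨_; _xor_; if_then_else_)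
open import Data.Bool.Properties
  using (xor-assoc; xor-identityʳ; xor-same; ∧-distribˡ-xor; ∧-distribʳ-xor; ∧-comm; ∧-zeroʳ;
         ∧-conicalʳ; ∨-zeroʳ; ¬-not; T-≡; if-float; xor-∧-commutativeRing; ∧-commutativeMonoid)
open import Data.Fin using (Fin; zero; suc; toℕ)
open import Data.Fin.Properties using (<-cmp)
open import Data.Fin.Subset using (Subset; ⁅_⁆; _∪_; _∈_; _∉_; _⊆_; ⊤; ⊥; Nonempty; ∣_∣)
open import Data.Fin.Subset.Properties
  using (x∈⁅x⁆; x∈⁅y⁆⇒x≡y; x∈p∪q⁺; ∣⁅x⁆∣≡1; p⊆q⇒∣p∣≤∣q∣; nonempty?; Empty-unique)
open import Data.List using (List; []; _∷_; _++_; map; concatMap; foldr; length)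
open import Data.List.Properties using (length-++-sucʳ; map-tabulate)
open import Data.List.Membership.Propositional using () renaming (_∈_ to _∈ₗ_)
open import Data.List.Membership.Propositional.Properties using (∈-∃++)
open import Data.List.Relation.Unary.Any using (here; there)
open import Data.List.Relation.Unary.All using (All; []; _∷_)
import Data.List.Relation.Unary.All as All
open import Data.List.Relation.Unary.All.Properties using (map⁺; ++⁺)
open import Data.Nat using (ℕ; zero; suc; _+_; _≤_; _<_; _∸_; z≤n; s≤s; _≟_; _≡ᵇ_; _<ᵇ_)
open import Data.Nat.Properties using (≤-refl; ≤-trans; n≤1+n; <-trans; <-irrefl; <⇒≱; +-mono-≤; <ᵇ⇒<; <⇒<ᵇ)
open import Data.Product using (Σ; _×_; _,_; proj₂)
open import Data.Sum using (inj₁; inj₂)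
open import Data.Vec using (Vec; []; _∷_; zipWith; lookup; tabulate; replicate; here; there)
open import Data.Vec.Properties using (≡-dec; lookup∘tabulate; lookup⇒[]=; []=⇒lookup; zipWith-replicate₁; map-id)
open import Function using (id; _∘_)
open import Function.Bundles using (Equivalence)
open import Relation.Binary.Definitions using (tri<; tri≈; tri>)
open import Relation.Binary.PropositionalEquality
open import Relation.Nullary using (¬_; does; yes; no; contradiction)
open import Relation.Nullary.Decidable using (dec-true)

open CommutativeSemigroupProperties (CommutativeMonoid.commutativeSemigroup ∧-commutativeMonoid)
  using () renaming (interchange to ∧-interchange)
open CommutativeSemigroupProperties (CommutativeRing.+-commutativeSemigroup xor-∧-commutativeRing)
  using () renaming (interchange to xor-interchange; x∙yz≈y∙xz to xor-swap)

private
  variable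
    n : ℕ

-- Linear functionals on F₂[x]

-- f ≈ g iff xorSum φ f ≡ xorSum φ g for every φ (xorSum-≡⇒≈, xorSum-resp-≈); evaluation at a point
-- is the functional with φ = monomialAt c.
xorSum : (Monomial n → Bool) → Poly n → Bool
xorSum φ []      = false
xorSum φ (β ∷ f) = φ β xor xorSum φ f

xorSum-++ : ∀ (φ : Monomial n → Bool) f g → xorSum φ (f ++ g) ≡ xorSum φ f xor xorSum φ g
xorSum-++ φ []      g = refl
xorSum-++ φ (β ∷ f) g = trans (cong (φ β xor_) (xorSum-++ φ f g)) (sym (xor-assoc (φ β) _ _))

xorSum-cong : ∀ {φ ψ : Monomial n → Bool} → (∀ β → φ β ≡ ψ β) → ∀ f → xorSum φ f ≡ xorSum ψ f
xorSum-cong φ≗ψ []      = refl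
xorSum-cong φ≗ψ (β ∷ f) = cong₂ _xor_ (φ≗ψ β) (xorSum-cong φ≗ψ f)

xorSum-map : ∀ {m} (φ : Monomial n → Bool) (h : Monomial m → Monomial n) f →
             xorSum φ (map h f) ≡ xorSum (λ β → φ (h β)) f
xorSum-map φ h []      = refl
xorSum-map φ h (β ∷ f) = cong (φ (h β) xor_) (xorSum-map φ h f)

xorSum-concatMap : ∀ {m} (φ : Monomial n → Bool) (h : Monomial m → Poly n) f →
                   xorSum φ (concatMap h f) ≡ xorSum (λ β → xorSum φ (h β)) f
xorSum-concatMap φ h []      = refl
xorSum-concatMap φ h (β ∷ f) =
  trans (xorSum-++ φ (h β) (concatMap h f)) (cong (xorSum φ (h β) xor_) (xorSum-concatMap φ h f))

xorSum-*p : ∀ (φ : Monomial n → Bool) f g →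
            xorSum φ (f *p g) ≡ xorSum (λ a → xorSum (λ b → φ (zipWith _+_ a b)) g) f
xorSum-*p φ f g =
  trans (xorSum-concatMap φ _ f) (xorSum-cong (λ a → xorSum-map φ (zipWith _+_ a) g) f)

xorSum-+p-*p : ∀ (φ : Monomial n → Bool) f g h →
               xorSum φ ((f +p g) *p h) ≡ xorSum φ (f *p h) xor xorSum φ (g *p h)
xorSum-+p-*p φ f g h = begin
  xorSum φ ((f ++ g) *p h)            ≡⟨ xorSum-*p φ (f ++ g) h ⟩
  xorSum ψ (f ++ g)                   ≡⟨ xorSum-++ ψ f g ⟩
  xorSum ψ f xor xorSum ψ g           ≡⟨ sym (cong₂ _xor_ (xorSum-*p φ f h) (xorSum-*p φ g h)) ⟩
  xorSum φ (f *p h) xor xorSum φ (g *p h) ∎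
  where
  open ≡-Reasoning
  ψ = λ a → xorSum (λ b → φ (zipWith _+_ a b)) h

xorSum-∧ˡ : ∀ x (φ : Monomial n → Bool) f → xorSum (λ β → x ∧ φ β) f ≡ x ∧ xorSum φ f
xorSum-∧ˡ x φ []      = sym (∧-zeroʳ x)
xorSum-∧ˡ x φ (β ∷ f) =
  trans (cong (x ∧ φ β xor_) (xorSum-∧ˡ x φ f)) (sym (∧-distribˡ-xor x (φ β) _))

δ : Monomial n → Monomial n → Bool
δ α β = does (≡-dec _≟_ β α)

coeff≡xorSum-δ : ∀ (f : Poly n) α → coeff f α ≡ xorSum (δ α) f
coeff≡xorSum-δ []      α = refl
coeff≡xorSum-δ (β ∷ f) α = cong (δ α β xor_) (coeff≡xorSum-δ f α)

xorSum-≡⇒≈ : ∀ (f g : Poly n) → (∀ φ → xorSum φ f ≡ xorSum φ g) → f ≈ g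
xorSum-≡⇒≈ f g eq α =
  trans (coeff≡xorSum-δ f α) (trans (eq (δ α)) (sym (coeff≡xorSum-δ g α)))

xor≡false⇒≡ : ∀ {a b} → a xor b ≡ false → a ≡ b
xor≡false⇒≡ {true}  {true}  _ = refl
xor≡false⇒≡ {false} {false} _ = refl
xor≡false⇒≡ {true}  {false} ()
xor≡false⇒≡ {false} {true}  ()

coeff≡true⇒∈ : ∀ (f : Poly n) {α} → coeff f α ≡ true → α ∈ₗ f
coeff≡true⇒∈ []      ()
coeff≡true⇒∈ (β ∷ f) {α} c with ≡-dec _≟_ β α
... | yes β≡α = here (sym β≡α)
... | no  _   = there (coeff≡true⇒∈ f c)

xorSum-middle : ∀ (φ : Monomial n → Bool) ys β zs →
                xorSum φ (ys ++ β ∷ zs) ≡ φ β xor xorSum φ (ys ++ zs)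
xorSum-middle φ []       β zs = refl
xorSum-middle φ (y ∷ ys) β zs =
  trans (cong (φ y xor_) (xorSum-middle φ ys β zs)) (xor-swap (φ y) (φ β) _)

coeff-∷≡false⇒coeff≡true : ∀ β (t : Poly n) → coeff (β ∷ t) β ≡ false → coeff t β ≡ true
coeff-∷≡false⇒coeff≡true β t c =
  sym (xor≡false⇒≡ (trans (cong (_xor coeff t β) (sym (dec-true (≡-dec _≟_ β β) refl))) c))

-- A list all of whose coefficients vanish consists of pairs of equal monomials; cancel one pair at a time.
xorSum-vanishes : ∀ (f : Poly n) → (∀ α → coeff f α ≡ false) → ∀ φ → xorSum φ f ≡ false
xorSum-vanishes f = go (length f) f ≤-refl
  where
  go : ∀ k (f : Poly n) → length f ≤ k → (∀ α → coeff f α ≡ false) → ∀ φ → xorSum φ f ≡ false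
  go _       []      _           _      _ = refl
  go (suc k) (β ∷ t) (s≤s |t|≤k) vanish φ
    with ∈-∃++ (coeff≡true⇒∈ t (coeff-∷≡false⇒coeff≡true β t (vanish β)))
  ... | ys , zs , refl = trans cancel (go k (ys ++ zs) shorter vanish′ φ)
    where
    cancel : ∀ {ψ} → xorSum ψ (β ∷ ys ++ β ∷ zs) ≡ xorSum ψ (ys ++ zs)
    cancel {ψ} = trans (cong (ψ β xor_) (xorSum-middle ψ ys β zs))
                       (trans (sym (xor-assoc (ψ β) (ψ β) _)) (cong (_xor _) (xor-same (ψ β))))
    shorter : length (ys ++ zs) ≤ k
    shorter = ≤-trans (n≤1+n _) (subst (_≤ k) (length-++-sucʳ ys β zs) |t|≤k)
    vanish′ : ∀ α → coeff (ys ++ zs) α ≡ false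
    vanish′ α = trans (coeff≡xorSum-δ (ys ++ zs) α)
                  (trans (sym cancel) (trans (sym (coeff≡xorSum-δ (β ∷ ys ++ β ∷ zs) α)) (vanish α)))

xorSum-resp-≈ : ∀ (f g : Poly n) → f ≈ g → ∀ φ → xorSum φ f ≡ xorSum φ g
xorSum-resp-≈ f g f≈g φ =
  xor≡false⇒≡ (trans (sym (xorSum-++ φ f g)) (xorSum-vanishes (f ++ g) cancels φ))
  where
  open ≡-Reasoning
  cancels : ∀ α → coeff (f ++ g) α ≡ false
  cancels α = begin
    coeff (f ++ g) α
      ≡⟨ coeff≡xorSum-δ (f ++ g) α ⟩
    xorSum (δ α) (f ++ g)
      ≡⟨ xorSum-++ (δ α) f g ⟩
    xorSum (δ α) f xor xorSum (δ α) g
      ≡⟨ sym (cong₂ _xor_ (coeff≡xorSum-δ f α) (coeff≡xorSum-δ g α)) ⟩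
    coeff f α xor coeff g α
      ≡⟨ cong (_xor coeff g α) (f≈g α) ⟩
    coeff g α xor coeff g α
      ≡⟨ xor-same (coeff g α) ⟩
    false
      ∎

zipWith-+-replicate-0 : ∀ (β : Monomial n) → zipWith _+_ (replicate n 0) β ≡ β
zipWith-+-replicate-0 β = trans (zipWith-replicate₁ _+_ 0 β) (map-id β)

zipWith-+-tabulate-0 : ∀ (β : Monomial n) → zipWith _+_ (tabulate (λ _ → 0)) β ≡ β
zipWith-+-tabulate-0 []      = refl
zipWith-+-tabulate-0 (e ∷ β) = cong (e ∷_) (zipWith-+-tabulate-0 β)

xorSum-1p*p : ∀ (φ : Monomial n → Bool) f → xorSum φ (1p *p f) ≡ xorSum φ f
xorSum-1p*p φ f = trans (xorSum-*p φ 1p f)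
  (trans (xor-identityʳ _) (xorSum-cong (λ β → cong φ (zipWith-+-replicate-0 β)) f))

raise₀ : Monomial (suc n) → Monomial (suc n)
raise₀ (e ∷ β) = suc e ∷ β

xorSum-x₀*p : ∀ (φ : Monomial (suc n) → Bool) f →
              xorSum φ (xv zero *p f) ≡ xorSum (λ β → φ (raise₀ β)) f
xorSum-x₀*p φ f = trans (xorSum-*p φ (xv zero) f) (trans (xor-identityʳ _) (xorSum-cong shift f))
  where
  shift : ∀ β → φ (zipWith _+_ (1 ∷ tabulate (λ _ → 0)) β) ≡ φ (raise₀ β)
  shift (e ∷ β) = cong (λ γ → φ (suc e ∷ γ)) (zipWith-+-tabulate-0 β)

-- sections es F φ = ⊕_{e ∈ es} F (φ ∘ (e ∷_)).  For F = xorSum · P this is xorSum φ of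
-- (Σ_{e ∈ es} x₀^e) · P, where P is read in the variables x₁, …, xₙ.
sections : List ℕ → ((Monomial n → Bool) → Bool) → (Monomial (suc n) → Bool) → Bool
sections []       F φ = false
sections (e ∷ es) F φ = F (λ β → φ (e ∷ β)) xor sections es F φ

sections-++ : ∀ es fs (F : (Monomial n → Bool) → Bool) φ →
              sections (es ++ fs) F φ ≡ sections es F φ xor sections fs F φ
sections-++ []       fs F φ = refl
sections-++ (e ∷ es) fs F φ =
  trans (cong (F _ xor_) (sections-++ es fs F φ)) (sym (xor-assoc (F _) _ _))

sections-xor : ∀ es (F G : (Monomial n → Bool) → Bool) φ →
               sections es (λ ψ → F ψ xor G ψ) φ ≡ sections es F φ xor sections es G φ
sections-xor []       F G φ = refl
sections-xor (e ∷ es) F G φ =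
  trans (cong ((F _ xor G _) xor_) (sections-xor es F G φ)) (xor-interchange (F _) (G _) _ _)

sections-cong : ∀ es {F G : (Monomial n → Bool) → Bool} → (∀ ψ → F ψ ≡ G ψ) → ∀ φ →
                sections es F φ ≡ sections es G φ
sections-cong []       F≗G φ = refl
sections-cong (e ∷ es) F≗G φ = cong₂ _xor_ (F≗G _) (sections-cong es F≗G φ)

sections-const-false : ∀ es (φ : Monomial (suc n) → Bool) → sections es (λ _ → false) φ ≡ false
sections-const-false []       φ = refl
sections-const-false (e ∷ es) φ = sections-const-false es φ

sections-raise₀ : ∀ es (F : (Monomial n → Bool) → Bool) φ →
                  sections es F (λ β → φ (raise₀ β)) ≡ sections (map suc es) F φ
sections-raise₀ []       F φ = refl
sections-raise₀ (e ∷ es) F φ = cong (F _ xor_) (sections-raise₀ es F φ)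

record Expansion (es : List ℕ) (X : Poly (suc n)) (P : Poly n) : Set where
  constructor expansion
  field xorSum≡sections : ∀ φ → xorSum φ X ≡ sections es (λ ψ → xorSum ψ P) φ
open Expansion

module _ {es : List ℕ} {X : Poly (suc n)} {P : Poly n} (X≈ : Expansion es X P) where

  expansion-1p*p : Expansion es (1p *p X) P
  expansion-1p*p = expansion λ φ → trans (xorSum-1p*p φ X) (xorSum≡sections X≈ φ)

  expansion-x₀*p : Expansion (map suc es) (xv zero *p X) P
  expansion-x₀*p = expansion λ φ →
    trans (xorSum-x₀*p φ X) (trans (xorSum≡sections X≈ _) (sections-raise₀ es (λ ψ → xorSum ψ P) φ))

  expansion-[1-x₀]*p : Expansion (es ++ map suc es) (1-x zero *p X) P
  expansion-[1-x₀]*p = expansion λ φ → trans (xorSum-+p-*p φ 1p (xv zero) X)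
    (trans (cong₂ _xor_ (xorSum≡sections expansion-1p*p φ) (xorSum≡sections expansion-x₀*p φ))
           (sym (sections-++ es (map suc es) (λ ψ → xorSum ψ P) φ)))

-- Over F₂, x₀^[s] (1 - x₀)^[t] = Σ_{e ∈ x₀-exponents s t} x₀^e.
x₀-exponents : Bool → Bool → List ℕ
x₀-exponents false false = 0 ∷ []
x₀-exponents true  false = 1 ∷ []
x₀-exponents false true  = 0 ∷ 1 ∷ []
x₀-exponents true  true  = 1 ∷ 2 ∷ []

expansion-x₀-factors : ∀ s t {X : Poly (suc n)} {P} → Expansion (0 ∷ []) X P →
  Expansion (x₀-exponents s t) ((if s then xv zero else 1p) *p ((if t then 1-x zero else 1p) *p X)) P
expansion-x₀-factors false false X≈ = expansion-1p*p (expansion-1p*p X≈)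
expansion-x₀-factors true  false X≈ = expansion-x₀*p (expansion-1p*p X≈)
expansion-x₀-factors false true  X≈ = expansion-1p*p (expansion-[1-x₀]*p X≈)
expansion-x₀-factors true  true  X≈ = expansion-x₀*p (expansion-[1-x₀]*p X≈)

record Lifts (P′ : Poly (suc n)) (P : Poly n) : Set where
  constructor lifts
  field xorSum-lifts : ∀ φ → xorSum φ P′ ≡ xorSum (λ β → φ (0 ∷ β)) P
open Lifts

lifts-*p : ∀ (F : Poly n) {P′ P} → Lifts P′ P → Lifts (map (0 ∷_) F *p P′) (F *p P)
lifts-*p F {P′} {P} P′↑P = lifts λ φ → let open ≡-Reasoning in begin
  xorSum φ (map (0 ∷_) F *p P′)
    ≡⟨ xorSum-*p φ (map (0 ∷_) F) P′ ⟩
  xorSum (λ a → xorSum (λ b → φ (zipWith _+_ a b)) P′) (map (0 ∷_) F)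
    ≡⟨ xorSum-map _ (0 ∷_) F ⟩
  xorSum (λ a → xorSum (λ b → φ (zipWith _+_ (0 ∷ a) b)) P′) F
    ≡⟨ xorSum-cong (λ a → xorSum-lifts P′↑P _) F ⟩
  xorSum (λ a → xorSum (λ b → φ (0 ∷ zipWith _+_ a b)) P) F
    ≡⟨ sym (xorSum-*p _ F P) ⟩
  xorSum (λ β → φ (0 ∷ β)) (F *p P)
    ∎

-- pm σ τ is definitionally foldr (pmStep σ τ) 1p (allFinL n).
pmStep : Subset n → Subset n → Fin n → Poly n → Poly n
pmStep σ τ i acc = (if lookup σ i then xv i else 1p) *p ((if lookup τ i then 1-x i else 1p) *p acc)

-- The factors at the indices suc k are definitionally those of pm σ τ at k with a 0 prepended to
-- every exponent vector, once map (0 ∷_) is floated out of the conditionals.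
lifts-pm-tail : ∀ s t (σ τ : Subset n) (l : List (Fin n)) →
                Lifts (foldr (pmStep (s ∷ σ) (t ∷ τ)) 1p (map suc l)) (foldr (pmStep σ τ) 1p l)
lifts-pm-tail s t σ τ []      = lifts λ φ → refl
lifts-pm-tail s t σ τ (k ∷ l) = lifts λ φ → trans
  (cong₂ (λ F G → xorSum φ (F *p (G *p foldr (pmStep (s ∷ σ) (t ∷ τ)) 1p (map suc l))))
         (sym (if-float (map (0 ∷_)) (lookup σ k))) (sym (if-float (map (0 ∷_)) (lookup τ k))))
  (xorSum-lifts (lifts-*p (if lookup σ k then xv k else 1p)
    (lifts-*p (if lookup τ k then 1-x k else 1p) (lifts-pm-tail s t σ τ l))) φ)

expansion-pm-∷ : ∀ s t (σ τ : Subset n) → Expansion (x₀-exponents s t) (pm (s ∷ σ) (t ∷ τ)) (pm σ τ)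
expansion-pm-∷ {n} s t σ τ = expansion λ φ → trans
  (cong (λ l → xorSum φ (pmStep (s ∷ σ) (t ∷ τ) zero (foldr (pmStep (s ∷ σ) (t ∷ τ)) 1p l)))
        (sym (map-tabulate id suc)))
  (xorSum≡sections (expansion-x₀-factors s t tail-expansion) φ)
  where
  tail-expansion : Expansion (0 ∷ []) (foldr (pmStep (s ∷ σ) (t ∷ τ)) 1p (map suc (allFinL n))) (pm σ τ)
  tail-expansion = expansion λ ψ →
    trans (xorSum-lifts (lifts-pm-tail s t σ τ (allFinL n)) ψ) (sym (xor-identityʳ _))

-- Evaluation at 0/1 points

-- x^β at the point c ∈ {0,1}ⁿ, with 0⁰ = 1.
monomialAt : Vec Bool n → Monomial n → Bool
monomialAt []      []      = true
monomialAt (c ∷ p) (e ∷ β) = ((e ≡ᵇ 0) ∨ c) ∧ monomialAt p β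

eval : Vec Bool n → Poly n → Bool
eval c = xorSum (monomialAt c)

≡ᵇ0-+ : ∀ x y c → ((x + y ≡ᵇ 0) ∨ c) ≡ ((x ≡ᵇ 0) ∨ c) ∧ ((y ≡ᵇ 0) ∨ c)
≡ᵇ0-+ zero    zero    c     = refl
≡ᵇ0-+ zero    (suc y) c     = refl
≡ᵇ0-+ (suc x) y       false = refl
≡ᵇ0-+ (suc x) y       true  = sym (∨-zeroʳ (y ≡ᵇ 0))

monomialAt-+ : ∀ (c : Vec Bool n) a b →
               monomialAt c (zipWith _+_ a b) ≡ monomialAt c a ∧ monomialAt c b
monomialAt-+ []      []      []      = refl
monomialAt-+ (c ∷ p) (x ∷ a) (y ∷ b) =
  trans (cong₂ _∧_ (≡ᵇ0-+ x y c) (monomialAt-+ p a b))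
        (∧-interchange ((x ≡ᵇ 0) ∨ c) ((y ≡ᵇ 0) ∨ c) (monomialAt p a) (monomialAt p b))

eval-*p : ∀ (c : Vec Bool n) f g → eval c (f *p g) ≡ eval c f ∧ eval c g
eval-*p c f g = begin
  eval c (f *p g)
    ≡⟨ xorSum-*p (monomialAt c) f g ⟩
  xorSum (λ a → xorSum (λ b → monomialAt c (zipWith _+_ a b)) g) f
    ≡⟨ xorSum-cong inner f ⟩
  xorSum (λ a → eval c g ∧ monomialAt c a) f
    ≡⟨ xorSum-∧ˡ (eval c g) (monomialAt c) f ⟩
  eval c g ∧ eval c f
    ≡⟨ ∧-comm (eval c g) (eval c f) ⟩
  eval c f ∧ eval c g
    ∎
  where
  open ≡-Reasoning
  inner : ∀ a → xorSum (λ b → monomialAt c (zipWith _+_ a b)) g ≡ eval c g ∧ monomialAt c a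
  inner a = trans (xorSum-cong (monomialAt-+ c a) g)
                  (trans (xorSum-∧ˡ (monomialAt c a) (monomialAt c) g)
                         (∧-comm (monomialAt c a) (eval c g)))

-- The value at a coordinate cᵢ of the factor xᵢ^[s] (1 - xᵢ)^[t].
factorAt : Bool → Bool → Bool → Bool
factorAt s t true  = not t
factorAt s t false = not s

pmAt : Subset n → Subset n → Vec Bool n → Bool
pmAt []      []      []      = true
pmAt (s ∷ σ) (t ∷ τ) (c ∷ p) = factorAt s t c ∧ pmAt σ τ p

evalX₀ : Bool → List ℕ → Bool
evalX₀ c = foldr (λ e r → ((e ≡ᵇ 0) ∨ c) xor r) false

evalX₀-exponents : ∀ s t c → evalX₀ c (x₀-exponents s t) ≡ factorAt s t c
evalX₀-exponents false false false = refl
evalX₀-exponents false false true  = refl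
evalX₀-exponents false true  false = refl
evalX₀-exponents false true  true  = refl
evalX₀-exponents true  false false = refl
evalX₀-exponents true  false true  = refl
evalX₀-exponents true  true  false = refl
evalX₀-exponents true  true  true  = refl

sections-monomialAt : ∀ c (p : Vec Bool n) es P →
  sections es (λ ψ → xorSum ψ P) (monomialAt (c ∷ p)) ≡ evalX₀ c es ∧ eval p P
sections-monomialAt c p []       P = refl
sections-monomialAt c p (e ∷ es) P =
  trans (cong₂ _xor_ (xorSum-∧ˡ ((e ≡ᵇ 0) ∨ c) (monomialAt p) P) (sections-monomialAt c p es P))
        (sym (∧-distribʳ-xor (eval p P) ((e ≡ᵇ 0) ∨ c) (evalX₀ c es)))

eval-pm : ∀ (σ τ c : Subset n) → eval c (pm σ τ) ≡ pmAt σ τ c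
eval-pm []      []      []      = refl
eval-pm (s ∷ σ) (t ∷ τ) (c ∷ p) = begin
  eval (c ∷ p) (pm (s ∷ σ) (t ∷ τ))
    ≡⟨ xorSum≡sections (expansion-pm-∷ s t σ τ) (monomialAt (c ∷ p)) ⟩
  sections (x₀-exponents s t) (λ ψ → xorSum ψ (pm σ τ)) (monomialAt (c ∷ p))
    ≡⟨ sections-monomialAt c p (x₀-exponents s t) (pm σ τ) ⟩
  evalX₀ c (x₀-exponents s t) ∧ eval p (pm σ τ)
    ≡⟨ cong₂ _∧_ (evalX₀-exponents s t c) (eval-pm σ τ p) ⟩
  factorAt s t c ∧ pmAt σ τ p
    ∎
  where open ≡-Reasoning

pmAt-σ : ∀ (σ τ c : Subset n) {k} → pmAt σ τ c ≡ true → k ∈ σ → k ∈ c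
pmAt-σ (true ∷ σ) (t ∷ τ) (true  ∷ c) _  here        = here
pmAt-σ (true ∷ σ) (t ∷ τ) (false ∷ c) () here
pmAt-σ (s    ∷ σ) (t ∷ τ) (b     ∷ c) at (there k∈σ) =
  there (pmAt-σ σ τ c (∧-conicalʳ _ _ at) k∈σ)

pmAt-τ : ∀ (σ τ c : Subset n) {k} → pmAt σ τ c ≡ true → k ∈ τ → k ∉ c
pmAt-τ (s ∷ σ) (true ∷ τ) (true ∷ c) () here here
pmAt-τ (s ∷ σ) (t    ∷ τ) (b    ∷ c) at (there k∈τ) (there k∈c) =
  pmAt-τ σ τ c (∧-conicalʳ _ _ at) k∈τ k∈c

Disjoint-tail : ∀ {s t} {σ τ : Subset n} → Disjoint (s ∷ σ) (t ∷ τ) → Disjoint σ τ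
Disjoint-tail d i i∈σ i∈τ = d (suc i) (there i∈σ) (there i∈τ)

pmAt-self : ∀ (σ τ : Subset n) → Disjoint σ τ → pmAt σ τ σ ≡ true
pmAt-self []           []           _ = refl
pmAt-self (true  ∷ σ) (true  ∷ τ) d = contradiction here (d zero here)
pmAt-self (true  ∷ σ) (false ∷ τ) d = pmAt-self σ τ (Disjoint-tail d)
pmAt-self (false ∷ σ) (t     ∷ τ) d = pmAt-self σ τ (Disjoint-tail d)

pmAt-⊤ : ∀ (σ : Subset n) → pmAt σ ⊥ ⊤ ≡ true
pmAt-⊤ []      = refl
pmAt-⊤ (s ∷ σ) = pmAt-⊤ σ

pmAt-⊥ : ∀ (τ : Subset n) → pmAt ⊥ τ ⊥ ≡ true
pmAt-⊥ []      = refl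
pmAt-⊥ (t ∷ τ) = pmAt-⊥ τ

pmAt-ρ : ∀ (v c : Subset n) → pmAt v (tabulate (λ i → not (lookup v i))) c ≡ true → c ≡ v
pmAt-ρ []          []          _  = refl
pmAt-ρ (true  ∷ v) (true  ∷ c) at = cong (true ∷_) (pmAt-ρ v c at)
pmAt-ρ (false ∷ v) (false ∷ c) at = cong (false ∷_) (pmAt-ρ v c at)
pmAt-ρ (true  ∷ v) (false ∷ c) ()
pmAt-ρ (false ∷ v) (true  ∷ c) ()

-- A pseudo-monomial with σ ∩ τ ≠ ∅ vanishes everywhere, a genuine one does not.
pm-overlap-≉ : ∀ {A B σ τ : Subset n} {i} → Disjoint σ τ → i ∈ A → i ∈ B → ¬ pm A B ≈ pm σ τ
pm-overlap-≉ {A = A} {B} {σ} {τ} d i∈A i∈B AB≈ =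
  pmAt-τ A B σ AB-at-σ i∈B (pmAt-σ A B σ AB-at-σ i∈A)
  where
  open ≡-Reasoning
  AB-at-σ : pmAt A B σ ≡ true
  AB-at-σ = begin
    pmAt A B σ       ≡⟨ sym (eval-pm A B σ) ⟩
    eval σ (pm A B)  ≡⟨ xorSum-resp-≈ (pm A B) (pm σ τ) AB≈ (monomialAt σ) ⟩
    eval σ (pm σ τ)  ≡⟨ eval-pm σ τ σ ⟩
    pmAt σ τ σ       ≡⟨ pmAt-self σ τ d ⟩
    true             ∎

-- The neural ideal

eval-ρ : ∀ (C : Code n) {c v} → C c → ¬ C v → eval c (ρ v) ≡ false
eval-ρ C {c} {v} c∈C v∉C =
  trans (eval-pm v (tabulate (λ i → not (lookup v i))) c)
        (¬-not λ at → v∉C (subst C (pmAt-ρ v c at) c∈C))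

eval-sumGen : ∀ (C : Code n) {c} → C c → ∀ L → All (λ p → ¬ C (proj₂ p)) L →
              eval c (sumGen L) ≡ false
eval-sumGen C         c∈C []            []          = refl
eval-sumGen C {c = c} c∈C ((g , v) ∷ L) (v∉C ∷ L∉C) = begin
  eval c ((g *p ρ v) ++ sumGen L)
    ≡⟨ xorSum-++ (monomialAt c) (g *p ρ v) (sumGen L) ⟩
  eval c (g *p ρ v) xor eval c (sumGen L)
    ≡⟨ cong₂ _xor_ (eval-*p c g (ρ v)) (eval-sumGen C c∈C L L∉C) ⟩
  (eval c g ∧ eval c (ρ v)) xor false
    ≡⟨ cong (λ b → (eval c g ∧ b) xor false) (eval-ρ C c∈C v∉C) ⟩
  (eval c g ∧ false) xor false
    ≡⟨ cong (_xor false) (∧-zeroʳ (eval c g)) ⟩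
  false
    ∎
  where open ≡-Reasoning

eval-∈J : ∀ (C : Code n) {c} f → C c → InNeuralIdeal C f → eval c f ≡ false
eval-∈J C {c} f c∈C (L , L∉C , f≈L) =
  trans (xorSum-resp-≈ f (sumGen L) f≈L (monomialAt c)) (eval-sumGen C c∈C L L∉C)

∈J-resp-≈ : ∀ {C : Code n} f g → f ≈ g → InNeuralIdeal C g → InNeuralIdeal C f
∈J-resp-≈ f g f≈g (L , L∉C , g≈L) = L , L∉C , λ α → trans (f≈g α) (g≈L α)

pm-∉J : ∀ (C : Code n) {c} σ τ → C c → pmAt σ τ c ≡ true → ¬ InNeuralIdeal C (pm σ τ)
pm-∉J C {c} σ τ c∈C at pm∈J =
  contradiction (trans (sym at) (trans (sym (eval-pm σ τ c)) (eval-∈J C (pm σ τ) c∈C pm∈J))) λ ()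

-- The points v with σ ⊆ v and v ∩ τ = ∅, i.e. those where pm σ τ does not vanish.
completions : Subset n → Subset n → List (Subset n)
completions []      []      = [] ∷ []
completions (s ∷ σ) (t ∷ τ) = extend s t (completions σ τ)
  where
  extend : Bool → Bool → List (Subset _) → List (Subset (suc _))
  extend true  false V = map (true ∷_) V
  extend false true  V = map (false ∷_) V
  extend false false V = map (true ∷_) V ++ map (false ∷_) V
  extend true  true  V = []

completions-sound : ∀ (σ τ : Subset n) → All (λ v → pmAt σ τ v ≡ true) (completions σ τ)
completions-sound []          []          = refl ∷ []
completions-sound (true  ∷ σ) (false ∷ τ) = map⁺ (completions-sound σ τ)
completions-sound (false ∷ σ) (true  ∷ τ) = map⁺ (completions-sound σ τ)
completions-sound (false ∷ σ) (false ∷ τ) =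
  ++⁺ (map⁺ (completions-sound σ τ)) (map⁺ (completions-sound σ τ))
completions-sound (true  ∷ σ) (true  ∷ τ) = []

ρSum : (Monomial n → Bool) → List (Subset n) → Bool
ρSum φ []      = false
ρSum φ (v ∷ V) = xorSum φ (ρ v) xor ρSum φ V

ρSum-++ : ∀ (φ : Monomial n → Bool) V U → ρSum φ (V ++ U) ≡ ρSum φ V xor ρSum φ U
ρSum-++ φ []      U = refl
ρSum-++ φ (v ∷ V) U =
  trans (cong (xorSum φ (ρ v) xor_) (ρSum-++ φ V U)) (sym (xor-assoc (xorSum φ (ρ v)) _ _))

ρSum-map-∷ : ∀ b (V : List (Subset n)) φ →
             ρSum φ (map (b ∷_) V) ≡ sections (x₀-exponents b (not b)) (λ ψ → ρSum ψ V) φ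
ρSum-map-∷ b []      φ = sym (sections-const-false (x₀-exponents b (not b)) φ)
ρSum-map-∷ b (v ∷ V) φ = trans
  (cong₂ _xor_ (xorSum≡sections (expansion-pm-∷ b (not b) v _) φ) (ρSum-map-∷ b V φ))
  (sym (sections-xor (x₀-exponents b (not b)) (λ ψ → xorSum ψ (ρ v)) (λ ψ → ρSum ψ V) φ))

ρSum-completions-∷ : ∀ s t (σ τ : Subset n) → ¬ (s ≡ true × t ≡ true) → ∀ φ →
  ρSum φ (completions (s ∷ σ) (t ∷ τ))
    ≡ sections (x₀-exponents s t) (λ ψ → ρSum ψ (completions σ τ)) φ
ρSum-completions-∷ true  false σ τ _ φ = ρSum-map-∷ true  (completions σ τ) φ
ρSum-completions-∷ false true  σ τ _ φ = ρSum-map-∷ false (completions σ τ) φ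
ρSum-completions-∷ true  true  σ τ ¬both φ = contradiction (refl , refl) ¬both
ρSum-completions-∷ false false σ τ _ φ = begin
  ρSum φ (map (true ∷_) V ++ map (false ∷_) V)      ≡⟨ ρSum-++ φ (map (true ∷_) V) _ ⟩
  ρSum φ (map (true ∷_) V) xor ρSum φ (map (false ∷_) V)
    ≡⟨ cong₂ _xor_ (ρSum-map-∷ true V φ) (ρSum-map-∷ false V φ) ⟩
  (F₁ xor false) xor (F₀ xor (F₁ xor false))        ≡⟨ xor-swap (F₁ xor false) F₀ _ ⟩
  F₀ xor ((F₁ xor false) xor (F₁ xor false))        ≡⟨ cong (F₀ xor_) (xor-same (F₁ xor false)) ⟩
  F₀ xor false                                      ∎
  where
  open ≡-Reasoning
  V = completions σ τ
  F₀ = ρSum (λ β → φ (0 ∷ β)) V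
  F₁ = ρSum (λ β → φ (1 ∷ β)) V

-- Expanding the free coordinates by xᵢ + (1 - xᵢ) = 1: pm σ τ = Σ_{v ∈ completions σ τ} ρ v.
xorSum-pm≡ρSum : ∀ (σ τ : Subset n) → Disjoint σ τ → ∀ φ →
                 xorSum φ (pm σ τ) ≡ ρSum φ (completions σ τ)
xorSum-pm≡ρSum []      []      _ φ = sym (xor-identityʳ _)
xorSum-pm≡ρSum (s ∷ σ) (t ∷ τ) d φ = begin
  xorSum φ (pm (s ∷ σ) (t ∷ τ))
    ≡⟨ xorSum≡sections (expansion-pm-∷ s t σ τ) φ ⟩
  sections (x₀-exponents s t) (λ ψ → xorSum ψ (pm σ τ)) φ
    ≡⟨ sections-cong (x₀-exponents s t) (xorSum-pm≡ρSum σ τ (Disjoint-tail d)) φ ⟩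
  sections (x₀-exponents s t) (λ ψ → ρSum ψ (completions σ τ)) φ
    ≡⟨ sym (ρSum-completions-∷ s t σ τ head-disjoint φ) ⟩
  ρSum φ (completions (s ∷ σ) (t ∷ τ))
    ∎
  where
  open ≡-Reasoning
  head-disjoint : ¬ (s ≡ true × t ≡ true)
  head-disjoint (refl , refl) = d zero here here

xorSum-ρGenerators : ∀ (φ : Monomial n → Bool) V → xorSum φ (sumGen (map (1p ,_) V)) ≡ ρSum φ V
xorSum-ρGenerators φ []      = refl
xorSum-ρGenerators φ (v ∷ V) = trans (xorSum-++ φ (1p *p ρ v) _)
  (cong₂ _xor_ (xorSum-1p*p φ (ρ v)) (xorSum-ρGenerators φ V))

pm-∈J : ∀ (C : Code n) {σ τ} → Disjoint σ τ → (∀ v → pmAt σ τ v ≡ true → ¬ C v) →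
        InNeuralIdeal C (pm σ τ)
pm-∈J C {σ} {τ} d vanish =
  map (1p ,_) V ,
  map⁺ (All.map (vanish _) (completions-sound σ τ)) ,
  xorSum-≡⇒≈ (pm σ τ) (sumGen (map (1p ,_) V))
    (λ φ → trans (xorSum-pm≡ρSum σ τ d φ) (sym (xorSum-ρGenerators φ V)))
  where V = completions σ τ

-- The prefix code

Nonempty⇒1≤∣p∣ : ∀ {p : Subset n} → Nonempty p → 1 ≤ ∣ p ∣
Nonempty⇒1≤∣p∣ {p = p} (x , x∈p) =
  subst (_≤ ∣ p ∣) (∣⁅x⁆∣≡1 x) (p⊆q⇒∣p∣≤∣q∣ λ y∈⁅x⁆ → subst (_∈ p) (sym (x∈⁅y⁆⇒x≡y x y∈⁅x⁆)) x∈p)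

Nonempty-⊆⁅x⁆ : ∀ {p : Subset n} {x} → p ⊆ ⁅ x ⁆ → Nonempty p → x ∈ p
Nonempty-⊆⁅x⁆ {p = p} {x} p⊆⁅x⁆ (y , y∈p) = subst (_∈ p) (x∈⁅y⁆⇒x≡y x (p⊆⁅x⁆ y∈p)) y∈p

module _ (C : Code n) where

  ∈J⇒Nonempty-τ : C ⊤ → ∀ σ τ → InNeuralIdeal C (pm σ τ) → Nonempty τ
  ∈J⇒Nonempty-τ ⊤∈C σ τ pm∈J with nonempty? τ
  ... | yes τ≠∅ = τ≠∅
  ... | no  τ=∅ = contradiction (subst (λ τ → InNeuralIdeal C (pm σ τ)) (Empty-unique τ=∅) pm∈J)
                                (pm-∉J C σ ⊥ ⊤∈C (pmAt-⊤ σ))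

  ∈J⇒Nonempty-σ : C ⊥ → ∀ σ τ → InNeuralIdeal C (pm σ τ) → Nonempty σ
  ∈J⇒Nonempty-σ ⊥∈C σ τ pm∈J with nonempty? σ
  ... | yes σ≠∅ = σ≠∅
  ... | no  σ=∅ = contradiction (subst (λ σ → InNeuralIdeal C (pm σ τ)) (Empty-unique σ=∅) pm∈J)
                                (pm-∉J C ⊥ τ ⊥∈C (pmAt-⊥ τ))

  ∈J⇒2≤degree : C ⊤ → C ⊥ → ∀ σ τ → InNeuralIdeal C (pm σ τ) → 2 ≤ ∣ σ ∣ + ∣ τ ∣
  ∈J⇒2≤degree ⊤∈C ⊥∈C σ τ pm∈J =
    +-mono-≤ (Nonempty⇒1≤∣p∣ (∈J⇒Nonempty-σ ⊥∈C σ τ pm∈J))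
             (Nonempty⇒1≤∣p∣ (∈J⇒Nonempty-τ ⊤∈C σ τ pm∈J))

prefix≡⊤ : ∀ n → prefix {n} n ≡ ⊤
prefix≡⊤ zero    = refl
prefix≡⊤ (suc n) = cong (true ∷_) (prefix≡⊤ n)

prefix≡⊥ : ∀ n → prefix {n} 0 ≡ ⊥
prefix≡⊥ zero    = refl
prefix≡⊥ (suc n) = cong (false ∷_) (prefix≡⊥ n)

⊤∈prefixCode : prefixCode n ⊤
⊤∈prefixCode {n} = n , ≤-refl , sym (prefix≡⊤ n)

⊥∈prefixCode : prefixCode n ⊥
⊥∈prefixCode {n} = 0 , z≤n , sym (prefix≡⊥ n)

lookup-prefix : ∀ m (k : Fin n) → lookup (prefix m) k ≡ (toℕ k <ᵇ m)
lookup-prefix m = lookup∘tabulate (λ i → toℕ i <ᵇ m)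

∈prefix⇒< : ∀ {m} {k : Fin n} → k ∈ prefix m → toℕ k < m
∈prefix⇒< {m = m} {k} k∈ =
  <ᵇ⇒< (toℕ k) m (Equivalence.from T-≡ (trans (sym (lookup-prefix m k)) ([]=⇒lookup k∈)))

<⇒∈prefix : ∀ {m} {k : Fin n} → toℕ k < m → k ∈ prefix m
<⇒∈prefix {m = m} {k} k<m =
  lookup⇒[]= k (prefix m) (trans (lookup-prefix m k) (Equivalence.to T-≡ (<⇒<ᵇ k<m)))

-- In J_𝒞 because a prefix containing b contains a; minimal because J_𝒞 contains no
-- pseudo-monomial of degree < 2.
pm⁅b⁆⁅a⁆∈CF : ∀ {a b : Fin n} → toℕ a < toℕ b → InCF (prefixCode n) (pm ⁅ b ⁆ ⁅ a ⁆)
pm⁅b⁆⁅a⁆∈CF {n} {a} {b} a<b = ⁅ b ⁆ , ⁅ a ⁆ , disjoint , (λ _ → refl) ,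
  pm-∈J (prefixCode n) disjoint not-prefix , minimal
  where
  disjoint : Disjoint ⁅ b ⁆ ⁅ a ⁆
  disjoint k k∈⁅b⁆ k∈⁅a⁆ with x∈⁅y⁆⇒x≡y b k∈⁅b⁆ | x∈⁅y⁆⇒x≡y a k∈⁅a⁆
  ... | refl | refl = <-irrefl refl a<b
  not-prefix : ∀ v → pmAt ⁅ b ⁆ ⁅ a ⁆ v ≡ true → ¬ prefixCode n v
  not-prefix v at (m , _ , refl) = pmAt-τ ⁅ b ⁆ ⁅ a ⁆ v at (x∈⁅x⁆ a)
    (<⇒∈prefix (<-trans a<b (∈prefix⇒< {m = m} (pmAt-σ ⁅ b ⁆ ⁅ a ⁆ v at (x∈⁅x⁆ b)))))
  minimal : ¬ (Σ _ λ σ′ → Σ _ λ τ′ → Disjoint σ′ τ′ × InNeuralIdeal (prefixCode n) (pm σ′ τ′) ×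
               (∣ σ′ ∣ + ∣ τ′ ∣ < ∣ ⁅ b ⁆ ∣ + ∣ ⁅ a ⁆ ∣) × (pm σ′ τ′ ∣p pm ⁅ b ⁆ ⁅ a ⁆))
  minimal (σ′ , τ′ , _ , pm∈J , smaller , _) =
    <⇒≱ (subst (∣ σ′ ∣ + ∣ τ′ ∣ <_) (cong₂ _+_ (∣⁅x⁆∣≡1 b) (∣⁅x⁆∣≡1 a)) smaller)
        (∈J⇒2≤degree (prefixCode n) ⊤∈prefixCode ⊥∈prefixCode σ′ τ′ pm∈J)

⁅i⁆∈GR : ∀ (i : Fin n) → InGR (prefixCode n) ⁅ i ⁆
⁅i⁆∈GR {n} i A B A⊆⁅i⁆ B⊆⁅i⁆ (σ , τ , disjoint , AB≈ , pm∈J , _) =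
  pm-overlap-≉ disjoint (Nonempty-⊆⁅x⁆ A⊆⁅i⁆ (∈J⇒Nonempty-σ C ⊥∈prefixCode A B AB∈J))
                        (Nonempty-⊆⁅x⁆ B⊆⁅i⁆ (∈J⇒Nonempty-τ C ⊤∈prefixCode A B AB∈J)) AB≈
  where
  C = prefixCode n
  AB∈J : InNeuralIdeal C (pm A B)
  AB∈J = ∈J-resp-≈ (pm A B) (pm σ τ) AB≈ pm∈J

⁅i⁆∪⁅j⁆∉GR : ∀ (i j : Fin n) → i ≢ j → ¬ InGR (prefixCode n) (⁅ i ⁆ ∪ ⁅ j ⁆)
⁅i⁆∪⁅j⁆∉GR i j i≢j gr with <-cmp i j
... | tri< i<j _ _ = gr ⁅ j ⁆ ⁅ i ⁆ (x∈p∪q⁺ ∘ inj₂) (x∈p∪q⁺ ∘ inj₁) (pm⁅b⁆⁅a⁆∈CF i<j)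
... | tri≈ _ i≡j _ = i≢j i≡j
... | tri> _ _ j<i = gr ⁅ i ⁆ ⁅ j ⁆ (x∈p∪q⁺ ∘ inj₁) (x∈p∪q⁺ ∘ inj₂) (pm⁅b⁆⁅a⁆∈CF j<i)

-- The argument works for any number of neurons.
mainTheorem14 : (m : ℕ) → 3 ≤ m →
    ((i : Fin (m ∸ 1)) → InGR (prefixCode (m ∸ 1)) ⁅ i ⁆) ×
    ((i j : Fin (m ∸ 1)) → i ≢ j → ¬ InGR (prefixCode (m ∸ 1)) (⁅ i ⁆ ∪ ⁅ j ⁆))
mainTheorem14 m _ = ⁅i⁆∈GR , ⁅i⁆∪⁅j⁆∉GR
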